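{- Let $A$ and $B$ be two subspaces of $\mathbb{Z}_{p^s}^n$, and let $C$ be a subspace of $\mathbb{Z}_{p^s}^n$ with $\dim(C)=\min\{\dim(A),\dim(B)\}$. Then $\mathrm{ad}(A,B)\leq \mathrm{ad}(A,C)+\mathrm{ad}(C,B)$.
   Context: $p$ is a prime, $s\ge1$, $R=\mathbb{Z}_{p^s}$; vectors are row vectors. A set $\{\alpha_1,\dots,\alpha_k\}\subseteq R^n$ is unimodular if the matrix with rows $\alpha_i$ has a right inverse. For a submodule $V$, $\dim(V)$ is the largest size of a unimodular subset. A $k$-subspace is a submodule with a unimodular basis of $k$ vectors; it is identified with a matrix whose rows form such a basis, and $\begin{pmatrix}X\\ Y\end{pmatrix}$ stacks representations. Inner rank $\rho(M)$: least $r$ with $M=CD$, $C$ having $r$ columns ($\rho(0)=0$). The arithmetic distance is $\mathrm{ad}(X,Y)=\rho\begin{pmatrix}X\\ Y\end{pmatrix}-\max\{\dim(X),\dim(Y)\}$. -}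

module Defs where

open import Data.Nat as ℕ using (ℕ; zero; suc; _^_; _⊔_; _⊓_)
open import Data.Integer as ℤ using (ℤ; +_; _-_; _*_; _+_)
open import Data.Integer.Divisibility as ℤD using ()
open import Data.Fin using (Fin; zero; suc; splitAt; _≟_)
open import Data.Sum using (inj₁; inj₂)
open import Data.Product using (Σ; ∃; _×_; _,_)
open import Relation.Nullary using (yes; no)

-- Elements of Z_{q} (q = p^s) are represented by integers; equality in Z_q
-- is congruence modulo q.
_≡[_]_ : ℤ → ℕ → ℤ → Set
x ≡[ q ] y = ℤD._∣_ (+ q) (x - y)

Mat : ℕ → ℕ → Set
Mat m n = Fin m → Fin n → ℤ

RowVec : ℕ → Set
RowVec n = Fin n → ℤ

sumℤ : ∀ {k} → (Fin k → ℤ) → ℤ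
sumℤ {zero}  f = + 0
sumℤ {suc k} f = f zero + sumℤ (λ i → f (suc i))

_⊗_ : ∀ {m k n} → Mat m k → Mat k n → Mat m n
(M ⊗ N) i j = sumℤ (λ l → M i l * N l j)

idMat : ∀ {k} → Mat k k
idMat i j with i ≟ j
... | yes _ = + 1
... | no  _ = + 0

MatEq : ℕ → ∀ {m n} → Mat m n → Mat m n → Set
MatEq q M N = ∀ i j → M i j ≡[ q ] N i j

Unimodular : ℕ → ∀ {k n} → Mat k n → Set
Unimodular q {k} {n} M = Σ (Mat n k) λ N → MatEq q (M ⊗ N) idMat

Submodule : ℕ → Set₁
Submodule n = RowVec n → Set

RowSpan : ℕ → ∀ {k n} → Mat k n → Submodule n
RowSpan q {k} X v = Σ (Fin k → ℤ) λ c → ∀ j → v j ≡[ q ] sumℤ (λ i → c i * X i j)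

IsDim : ℕ → ∀ {n} → Submodule n → ℕ → Set
IsDim q {n} V d =
  (Σ (Mat d n) λ α → (∀ i → V (α i)) × Unimodular q α) ×
  (∀ d' (α : Mat d' n) → (∀ i → V (α i)) → Unimodular q α → d' ℕ.≤ d)

-- k-subspace: represented by a k×n matrix with unimodular rows
IsSubspaceRep : ℕ → ∀ {k n} → Mat k n → Set
IsSubspaceRep q X = Unimodular q X

IsInnerRank : ℕ → ∀ {m n} → Mat m n → ℕ → Set
IsInnerRank q {m} {n} M r =
  (Σ (Mat m r) λ C → Σ (Mat r n) λ D → MatEq q (C ⊗ D) M) ×
  (∀ r' (C : Mat m r') (D : Mat r' n) → MatEq q (C ⊗ D) M → r ℕ.≤ r')

stack : ∀ {k l n} → Mat k n → Mat l n → Mat (k ℕ.+ l) n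
stack {k} X Y i with splitAt k i
... | inj₁ a = X a
... | inj₂ b = Y b

adVal : ℕ → ℕ → ℕ → ℤ
adVal r dX dY = + r - + (dX ⊔ dY)

IsAd : ℕ → ∀ {k l n} → Mat k n → Mat l n → ℤ → Set
IsAd q {k} {l} {n} X Y a =
  ∃ λ r → ∃ λ dX → ∃ λ dY →
    IsInnerRank q (stack X Y) r × IsDim q (RowSpan q X) dX ×
    IsDim q (RowSpan q Y) dY × a ≡ adVal r dX dY
  where open import Relation.Binary.PropositionalEquality using (_≡_)

-- Write ρ(X; Y) for the inner rank of X stacked on Y.  Since dim C = min(dim A, dim B),
-- the inequality is equivalent to ρ(A; B) + dim C ≤ ρ(A; C) + ρ(C; B).  A factorisation
-- of (A; C) yields ρ(A; C) vectors G₁ spanning the rows of A and C, one of (C; B) yields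
-- ρ(C; B) vectors G₂ spanning those of C and B, and G₁ ∪ G₂ spans A and B.  The point is
-- that a unimodular family α of dim C vectors of C, lying in both spans, lets us shrink
-- G₁ ∪ G₂ by one vector per member of α: if α₀ ν = 1, then in any expression of α₀ over
-- G₁ some coefficient is a unit (Z_{p^s} is local), so the projection v ↦ v − (v ν) α₀
-- maps span G₁ onto the span of the images of the other generators; the same holds for
-- G₂, and adding α₀ back costs one vector, a net saving of one.
module Submission where

open import Defs
open import Data.Nat using (ℕ; _^_; _≥_; _⊓_)
open import Data.Nat.Primality using (Prime)
open import Data.Integer using (ℤ; _+_; _≤_)
open import Relation.Binary.PropositionalEquality using (_≡_)

import Data.Nat as ℕ
import Data.Nat.Properties as ℕP
import Data.Nat.Divisibility as ℕ∣
open import Data.Nat.Primality using (prime⇒irreducible; prime⇒nonTrivial)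
open import Data.Nat.Coprimality using (Coprime; coprime-divisor; coprime-Bézout)
open import Data.Nat.GCD using (module Bézout)
open import Data.Integer using (+_; -[1+_]; -_; _-_; _*_; ∣_∣; +≤+)
import Data.Integer.Properties as ℤP
open import Data.Integer.Divisibility.Signed using (_∣_; divides; _∣?_; ∣ᵤ⇒∣; ∣⇒∣ᵤ;
  ∣-trans; ∣m∣n⇒∣m+n; ∣m⇒∣-m; ∣n⇒∣m*n; ∣m⇒∣m*n)
open import Data.Integer.Tactic.RingSolver using (solve-∀)
import Algebra.Properties.Semiring.Sum ℤP.+-*-semiring as Σ
open import Data.Fin using (Fin; zero; suc; punchIn; punchOut; _↑ˡ_; _↑ʳ_; splitAt)
import Data.Fin as Fin
import Data.Fin.Properties as FinP
open import Data.Vec.Functional using (_∷_)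
open import Data.Product using (Σ; ∃; _×_; _,_; proj₁; proj₂)
open import Data.Sum using (inj₁; inj₂)
open import Data.Empty using (⊥-elim)
open import Relation.Nullary using (¬_; yes; no)
open import Relation.Binary.Bundles using (Setoid)
open import Relation.Binary.PropositionalEquality
  using (_≢_; refl; sym; trans; cong; cong₂; subst; subst₂; module ≡-Reasoning)

sumℤ≡sum : ∀ {k} (f : Fin k → ℤ) → sumℤ f ≡ Σ.sum f
sumℤ≡sum {ℕ.zero}  f = refl
sumℤ≡sum {ℕ.suc k} f = cong (_+_ (f zero)) (sumℤ≡sum (λ i → f (suc i)))

sumℤ-cong : ∀ {k} {f g : Fin k → ℤ} → (∀ i → f i ≡ g i) → sumℤ f ≡ sumℤ g
sumℤ-cong {ℕ.zero}  f≗g = refl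
sumℤ-cong {ℕ.suc k} f≗g = cong₂ _+_ (f≗g zero) (sumℤ-cong (λ i → f≗g (suc i)))

sumℤ-+ : ∀ {k} (f g : Fin k → ℤ) → sumℤ (λ i → f i + g i) ≡ sumℤ f + sumℤ g
sumℤ-+ f g = begin
  sumℤ (λ i → f i + g i)    ≡⟨ sumℤ≡sum (λ i → f i + g i) ⟩
  Σ.sum (λ i → f i + g i)   ≡⟨ Σ.∑-distrib-+ f g ⟩
  Σ.sum f + Σ.sum g         ≡⟨ cong₂ _+_ (sumℤ≡sum f) (sumℤ≡sum g) ⟨
  sumℤ f + sumℤ g           ∎
  where open ≡-Reasoning

sumℤ-*ˡ : ∀ {k} a (f : Fin k → ℤ) → sumℤ (λ i → a * f i) ≡ a * sumℤ f
sumℤ-*ˡ a f = begin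
  sumℤ (λ i → a * f i)    ≡⟨ sumℤ≡sum (λ i → a * f i) ⟩
  Σ.sum (λ i → a * f i)   ≡⟨ Σ.*-distribˡ-sum a f ⟨
  a * Σ.sum f             ≡⟨ cong (a *_) (sumℤ≡sum f) ⟨
  a * sumℤ f              ∎
  where open ≡-Reasoning

sumℤ-punchIn : ∀ {k} (j : Fin (ℕ.suc k)) (f : Fin (ℕ.suc k) → ℤ) →
  sumℤ f ≡ f j + sumℤ (λ i → f (punchIn j i))
sumℤ-punchIn j f = begin
  sumℤ f                                ≡⟨ sumℤ≡sum f ⟩
  Σ.sum f                               ≡⟨ Σ.sum-remove {i = j} f ⟩
  f j + Σ.sum (λ i → f (punchIn j i))   ≡⟨ cong (_+_ (f j)) (sumℤ≡sum (λ i → f (punchIn j i))) ⟨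
  f j + sumℤ (λ i → f (punchIn j i))    ∎
  where open ≡-Reasoning

sumℤ-0 : ∀ {k} → sumℤ {k} (λ _ → + 0) ≡ + 0
sumℤ-0 {ℕ.zero}  = refl
sumℤ-0 {ℕ.suc k} = trans (ℤP.+-identityˡ _) (sumℤ-0 {k})

sumℤ-∣ : ∀ {k} {d} {f : Fin k → ℤ} → (∀ i → d ∣ f i) → d ∣ sumℤ f
sumℤ-∣ {ℕ.zero}  d∣f = divides (+ 0) refl
sumℤ-∣ {ℕ.suc k} d∣f = ∣m∣n⇒∣m+n (d∣f zero) (sumℤ-∣ (λ i → d∣f (suc i)))

-- Unlike idMat, defined by recursion so that δ (suc i) (suc j) reduces to δ i j.
δ : ∀ {k} → Fin k → Fin k → ℤ
δ zero    zero    = + 1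
δ zero    (suc _) = + 0
δ (suc _) zero    = + 0
δ (suc i) (suc j) = δ i j

sumℤ-δ : ∀ {k} (i : Fin k) (f : Fin k → ℤ) → sumℤ (λ l → δ i l * f l) ≡ f i
sumℤ-δ {ℕ.suc k} zero f =
  trans (cong₂ _+_ (ℤP.*-identityˡ (f zero)) (sumℤ-0 {k})) (ℤP.+-identityʳ (f zero))
sumℤ-δ (suc i) f = trans (ℤP.+-identityˡ _) (sumℤ-δ i (λ l → f (suc l)))

idMat≡δ : ∀ {k} (i j : Fin k) → idMat i j ≡ δ i j
idMat≡δ i j with i Fin.≟ j
... | yes refl = sym (δ-diag i)
  where δ-diag : ∀ {k} (i : Fin k) → δ i i ≡ + 1
        δ-diag zero    = refl
        δ-diag (suc i) = δ-diag i
... | no i≢j = sym (δ-off i j i≢j)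
  where δ-off : ∀ {k} (i j : Fin k) → i ≢ j → δ i j ≡ + 0
        δ-off zero    zero    i≢j = ⊥-elim (i≢j refl)
        δ-off zero    (suc j) _   = refl
        δ-off (suc i) zero    _   = refl
        δ-off (suc i) (suc j) i≢j = δ-off i j (λ i≡j → i≢j (cong suc i≡j))

punchIn-elim : ∀ {r} {P : Fin (ℕ.suc r) → Set} (j : Fin (ℕ.suc r)) →
  P j → (∀ i → P (punchIn j i)) → ∀ i → P i
punchIn-elim {P = P} j Pj P∘punchIn i with j Fin.≟ i
... | yes refl = Pj
... | no j≢i = subst P (FinP.punchIn-punchOut j≢i) (P∘punchIn (punchOut j≢i))

dot : ∀ {n} → (Fin n → ℤ) → (Fin n → ℤ) → ℤ
dot v w = sumℤ (λ l → v l * w l)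

dot-*+ : ∀ {n} a (u v w : Fin n → ℤ) → dot (λ l → a * u l + v l) w ≡ a * dot u w + dot v w
dot-*+ a u v w = begin
  dot (λ l → a * u l + v l) w                          ≡⟨ sumℤ-cong (λ l → distrib a (u l) (v l) (w l)) ⟩
  sumℤ (λ l → a * (u l * w l) + v l * w l)             ≡⟨ sumℤ-+ (λ l → a * (u l * w l)) (λ l → v l * w l) ⟩
  sumℤ (λ l → a * (u l * w l)) + dot v w               ≡⟨ cong (_+ dot v w) (sumℤ-*ˡ a (λ l → u l * w l)) ⟩
  a * dot u w + dot v w                                ∎
  where
    open ≡-Reasoning
    distrib : ∀ a u v w → (a * u + v) * w ≡ a * (u * w) + v * w
    distrib = solve-∀

pos-1+*≡* : ∀ x a y b → 1 ℕ.+ x ℕ.* a ≡ y ℕ.* b → + 1 + + x * + a ≡ + y * + b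
pos-1+*≡* x a y b eq = begin
  + 1 + + x * + a      ≡⟨ cong (_+_ (+ 1)) (ℤP.pos-* x a) ⟨
  + (1 ℕ.+ x ℕ.* a)    ≡⟨ cong +_ eq ⟩
  + (y ℕ.* b)          ≡⟨ ℤP.pos-* y b ⟩
  + y * + b            ∎
  where open ≡-Reasoning

module Congruence (m : ℕ) where

  infix 4 _≈_
  record _≈_ (x y : ℤ) : Set where
    constructor mk≈
    field ∣-difference : + m ∣ x - y

  open _≈_ public

  private
    by : ∀ {a b} → a ≡ b → + m ∣ a → + m ∣ b
    by = subst (+ m ∣_)

  ≈-reflexive : ∀ {x y} → x ≡ y → x ≈ y
  ≈-reflexive {x} refl = mk≈ (by (sym (ℤP.+-inverseʳ x)) (divides (+ 0) refl))

  ≈-refl : ∀ {x} → x ≈ x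
  ≈-refl = ≈-reflexive refl

  ≈-sym : ∀ {x y} → x ≈ y → y ≈ x
  ≈-sym {x} {y} (mk≈ m∣x-y) = mk≈ (by (flip x y) (∣m⇒∣-m m∣x-y))
    where flip : ∀ x y → - (x - y) ≡ y - x
          flip = solve-∀

  ≈-trans : ∀ {x y z} → x ≈ y → y ≈ z → x ≈ z
  ≈-trans {x} {y} {z} (mk≈ m∣x-y) (mk≈ m∣y-z) = mk≈ (by (telescope x y z) (∣m∣n⇒∣m+n m∣x-y m∣y-z))
    where telescope : ∀ x y z → (x - y) + (y - z) ≡ x - z
          telescope = solve-∀

  ≈-setoid : Setoid _ _
  ≈-setoid = record { Carrier = ℤ ; _≈_ = _≈_
    ; isEquivalence = record { refl = ≈-refl ; sym = ≈-sym ; trans = ≈-trans } }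

  +-cong : ∀ {x x' y y'} → x ≈ x' → y ≈ y' → x + y ≈ x' + y'
  +-cong {x} {x'} {y} {y'} (mk≈ m∣x-x') (mk≈ m∣y-y') =
    mk≈ (by (regroup x x' y y') (∣m∣n⇒∣m+n m∣x-x' m∣y-y'))
    where regroup : ∀ x x' y y' → (x - x') + (y - y') ≡ (x + y) - (x' + y')
          regroup = solve-∀

  +-congˡ : ∀ a {y y'} → y ≈ y' → a + y ≈ a + y'
  +-congˡ a = +-cong (≈-refl {a})

  -‿cong : ∀ {x y} → x ≈ y → - x ≈ - y
  -‿cong {x} {y} (mk≈ m∣x-y) = mk≈ (by (negate x y) (∣m⇒∣-m m∣x-y))
    where negate : ∀ x y → - (x - y) ≡ - x - - y
          negate = solve-∀

  *-congˡ : ∀ a {x y} → x ≈ y → a * x ≈ a * y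
  *-congˡ a {x} {y} (mk≈ m∣x-y) = mk≈ (by (distrib a x y) (∣n⇒∣m*n a m∣x-y))
    where distrib : ∀ a x y → a * (x - y) ≡ a * x - a * y
          distrib = solve-∀

  *-congʳ : ∀ a {x y} → x ≈ y → x * a ≈ y * a
  *-congʳ a {x} {y} x≈y =
    ≈-trans (≈-reflexive (ℤP.*-comm x a)) (≈-trans (*-congˡ a x≈y) (≈-reflexive (ℤP.*-comm a y)))

  sumℤ-≈ : ∀ {k} {f g : Fin k → ℤ} → (∀ i → f i ≈ g i) → sumℤ f ≈ sumℤ g
  sumℤ-≈ {ℕ.zero}  f≈g = ≈-refl
  sumℤ-≈ {ℕ.suc k} f≈g = +-cong (f≈g zero) (sumℤ-≈ (λ i → f≈g (suc i)))

  dot-congˡ : ∀ {n} {v v' : Fin n → ℤ} w → (∀ l → v l ≈ v' l) → dot v w ≈ dot v' w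
  dot-congˡ w v≈v' = sumℤ-≈ (λ l → *-congʳ (w l) (v≈v' l))

  ≈⇒∣-difference : ∀ {d x y} → d ∣ + m → x ≈ y → d ∣ x - y
  ≈⇒∣-difference d∣m (mk≈ m∣x-y) = ∣-trans d∣m m∣x-y

  ∣-resp-≈ : ∀ {d x y} → d ∣ + m → x ≈ y → d ∣ y → d ∣ x
  ∣-resp-≈ {d} {x} {y} d∣m x≈y d∣y =
    subst (d ∣_) (split x y) (∣m∣n⇒∣m+n (≈⇒∣-difference d∣m x≈y) d∣y)
    where split : ∀ x y → (x - y) + y ≡ x
          split = solve-∀

  ≡[]⇒≈ : ∀ {x y} → x ≡[ m ] y → x ≈ y
  ≡[]⇒≈ m∣x-y = mk≈ (∣ᵤ⇒∣ m∣x-y)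

  ≈⇒≡[] : ∀ {x y} → x ≈ y → x ≡[ m ] y
  ≈⇒≡[] (mk≈ m∣x-y) = ∣⇒∣ᵤ m∣x-y

  coprime⇒invertible : ∀ {a} → Coprime a m → ∃ λ u → + a * u ≈ + 1
  coprime⇒invertible {a} a⊥m with coprime-Bézout a⊥m
  ... | Bézout.+- x y eq = + x , mk≈ (divides (+ y) (begin
        + a * + x - + 1         ≡⟨ cong (_- + 1) (ℤP.*-comm (+ a) (+ x)) ⟩
        + x * + a - + 1         ≡⟨ cong (_- + 1) (pos-1+*≡* y m x a eq) ⟨
        + 1 + + y * + m - + 1   ≡⟨ cancel (+ y * + m) ⟩
        + y * + m               ∎))
    where open ≡-Reasoning
          cancel : ∀ t → + 1 + t - + 1 ≡ t
          cancel = solve-∀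
  ... | Bézout.-+ x y eq = - + x , mk≈ (divides (- + y) (begin
        + a * - + x - + 1       ≡⟨ rearrange (+ a) (+ x) ⟩
        - (+ 1 + + x * + a)     ≡⟨ cong -_ (pos-1+*≡* x a y m eq) ⟩
        - (+ y * + m)           ≡⟨ ℤP.neg-distribˡ-* (+ y) (+ m) ⟩
        - + y * + m             ∎))
    where open ≡-Reasoning
          rearrange : ∀ a x → a * - x - + 1 ≡ - (+ 1 + x * a)
          rearrange = solve-∀

  ∣a∣-invertible⇒invertible : ∀ a {u} → + ∣ a ∣ * u ≈ + 1 → ∃ λ v → a * v ≈ + 1
  ∣a∣-invertible⇒invertible (+ k)    {u} ku≈1 = u , ku≈1
  ∣a∣-invertible⇒invertible -[1+ k ] {u} ku≈1 = - u , ≈-trans (≈-reflexive (negate (+ ℕ.suc k) u)) ku≈1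
    where negate : ∀ b u → (- b) * (- u) ≡ b * u
          negate = solve-∀

module _ {p : ℕ} (p-prime : Prime p) where

  divisor-of-prime-power : ∀ s {d} → d ℕ∣.∣ p ^ s → ¬ p ℕ∣.∣ d → d ≡ 1
  divisor-of-prime-power ℕ.zero    d∣1   _   = ℕ∣.∣1⇒≡1 d∣1
  divisor-of-prime-power (ℕ.suc s) d∣pps p∤d = divisor-of-prime-power s (coprime-divisor d⊥p d∣pps) p∤d
    where d⊥p : Coprime _ p
          d⊥p (i∣d , i∣p) with prime⇒irreducible p-prime i∣p
          ... | inj₁ i≡1 = i≡1
          ... | inj₂ refl = ⊥-elim (p∤d i∣d)

  invertible-mod-prime-power : ∀ s a → ¬ (+ p ∣ a) → ∃ λ u → Congruence._≈_ (p ^ s) (a * u) (+ 1)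
  invertible-mod-prime-power s a p∤a = ∣a∣-invertible⇒invertible a (proj₂ (coprime⇒invertible ∣a∣⊥pˢ))
    where
      open Congruence (p ^ s)
      ∣a∣⊥pˢ : Coprime ∣ a ∣ (p ^ s)
      ∣a∣⊥pˢ (d∣a , d∣pˢ) = divisor-of-prime-power s d∣pˢ (λ p∣d → p∤a (∣ᵤ⇒∣ (ℕ∣.∣-trans p∣d d∣a)))

stack-↑ˡ : ∀ {k l n} (X : Mat k n) (Y : Mat l n) i → stack X Y (i ↑ˡ l) ≡ X i
stack-↑ˡ {k} {l} X Y i rewrite FinP.splitAt-↑ˡ k i l = refl

stack-↑ʳ : ∀ {k l n} (X : Mat k n) (Y : Mat l n) i → stack X Y (k ↑ʳ i) ≡ Y i
stack-↑ʳ {k} {l} X Y i rewrite FinP.splitAt-↑ʳ k l i = refl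

module Spans (q n : ℕ) where

  open Congruence q

  linComb : ∀ {k} → (Fin k → ℤ) → Mat k n → RowVec n
  linComb c Q j = sumℤ (λ i → c i * Q i j)

  infix 4 _∈Span_ _⊆Span_

  _∈Span_ : ∀ {k} → RowVec n → Mat k n → Set
  _∈Span_ {k} v Q = Σ (Fin k → ℤ) λ c → ∀ j → v j ≈ linComb c Q j

  _⊆Span_ : ∀ {k l} → Mat k n → Mat l n → Set
  P ⊆Span Q = ∀ i → P i ∈Span Q

  linComb-* : ∀ {k} a (c : Fin k → ℤ) Q j → linComb (λ i → a * c i) Q j ≡ a * linComb c Q j
  linComb-* a c Q j =
    trans (sumℤ-cong (λ i → ℤP.*-assoc a (c i) (Q i j))) (sumℤ-*ˡ a (λ i → c i * Q i j))

  linComb-+ : ∀ {k} (c d : Fin k → ℤ) Q j → linComb (λ i → c i + d i) Q j ≡ linComb c Q j + linComb d Q j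
  linComb-+ c d Q j =
    trans (sumℤ-cong (λ i → ℤP.*-distribʳ-+ (Q i j) (c i) (d i)))
          (sumℤ-+ (λ i → c i * Q i j) (λ i → d i * Q i j))

  ∈Span-resp-≈ : ∀ {k} {Q : Mat k n} {v w} → (∀ j → v j ≈ w j) → w ∈Span Q → v ∈Span Q
  ∈Span-resp-≈ v≈w (c , w≈cQ) = c , λ j → ≈-trans (v≈w j) (w≈cQ j)

  0∈Span : ∀ {k} {Q : Mat k n} → (λ _ → + 0) ∈Span Q
  0∈Span {k} = (λ _ → + 0) , λ j → ≈-reflexive (sym (sumℤ-0 {k}))

  ∈Span-+ : ∀ {k} {Q : Mat k n} {v w} → v ∈Span Q → w ∈Span Q → (λ j → v j + w j) ∈Span Q
  ∈Span-+ {Q = Q} (c , v≈cQ) (d , w≈dQ) =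
    (λ i → c i + d i) , λ j → ≈-trans (+-cong (v≈cQ j) (w≈dQ j)) (≈-reflexive (sym (linComb-+ c d Q j)))

  ∈Span-* : ∀ {k} {Q : Mat k n} a {v} → v ∈Span Q → (λ j → a * v j) ∈Span Q
  ∈Span-* {Q = Q} a (c , v≈cQ) =
    (λ i → a * c i) , λ j → ≈-trans (*-congˡ a (v≈cQ j)) (≈-reflexive (sym (linComb-* a c Q j)))

  ⊆Span-refl : ∀ {k} (Q : Mat k n) → Q ⊆Span Q
  ⊆Span-refl Q i = δ i , λ j → ≈-reflexive (sym (sumℤ-δ i (λ l → Q l j)))

  linComb∈Span : ∀ {k l} {P : Mat k n} {Q : Mat l n} → P ⊆Span Q → ∀ c → linComb c P ∈Span Q
  linComb∈Span {ℕ.zero}  P⊆Q c = 0∈Span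
  linComb∈Span {ℕ.suc k} P⊆Q c =
    ∈Span-+ (∈Span-* (c zero) (P⊆Q zero)) (linComb∈Span (λ i → P⊆Q (suc i)) (λ i → c (suc i)))

  ∈Span-⊆ : ∀ {k l} {P : Mat k n} {Q : Mat l n} → P ⊆Span Q → ∀ {v} → v ∈Span P → v ∈Span Q
  ∈Span-⊆ P⊆Q (c , v≈cP) = ∈Span-resp-≈ v≈cP (linComb∈Span P⊆Q c)

  ⊆Span-trans : ∀ {k l t} {P : Mat k n} {Q : Mat l n} {R : Mat t n} → P ⊆Span Q → Q ⊆Span R → P ⊆Span R
  ⊆Span-trans P⊆Q Q⊆R i = ∈Span-⊆ Q⊆R (P⊆Q i)

  stack-⊆Spanˡ : ∀ {k l t} (X : Mat k n) (Y : Mat l n) {Q : Mat t n} → stack X Y ⊆Span Q → X ⊆Span Q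
  stack-⊆Spanˡ {l = l} X Y {Q} XY⊆Q i = subst (_∈Span Q) (stack-↑ˡ X Y i) (XY⊆Q (i ↑ˡ l))

  stack-⊆Spanʳ : ∀ {k l t} (X : Mat k n) (Y : Mat l n) {Q : Mat t n} → stack X Y ⊆Span Q → Y ⊆Span Q
  stack-⊆Spanʳ {k} X Y {Q} XY⊆Q i = subst (_∈Span Q) (stack-↑ʳ X Y i) (XY⊆Q (k ↑ʳ i))

  stack-⊆Span : ∀ {k l t} {X : Mat k n} {Y : Mat l n} {Q : Mat t n} →
    X ⊆Span Q → Y ⊆Span Q → stack X Y ⊆Span Q
  stack-⊆Span {k} X⊆Q Y⊆Q i with splitAt k i
  ... | inj₁ a = X⊆Q a
  ... | inj₂ b = Y⊆Q b

  rowSpan⇒∈Span : ∀ {k} {X : Mat k n} {v} → RowSpan q X v → v ∈Span X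
  rowSpan⇒∈Span (c , v≡cX) = c , λ j → ≡[]⇒≈ (v≡cX j)

  factorisation⇒⊆Span : ∀ {m r} {M : Mat m n} (F : Mat m r) (G : Mat r n) → MatEq q (F ⊗ G) M → M ⊆Span G
  factorisation⇒⊆Span F G FG≡M i = F i , λ j → ≈-sym (≡[]⇒≈ (FG≡M i j))

  innerRank≤ : ∀ {m r t} {M : Mat m n} {Q : Mat t n} → IsInnerRank q M r → M ⊆Span Q → r ℕ.≤ t
  innerRank≤ {t = t} {Q = Q} (_ , minimal) M⊆Q =
    minimal t (λ i → proj₁ (M⊆Q i)) Q (λ i j → ≈⇒≡[] (≈-sym (proj₂ (M⊆Q i) j)))

module Projection (q n : ℕ) (c ν : Fin n → ℤ) (c·ν≈1 : Congruence._≈_ q (dot c ν) (+ 1)) where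

  open Congruence q
  open Spans q n

  π : RowVec n → RowVec n
  π v l = v l - dot v ν * c l

  π-cong : ∀ {v w} → (∀ l → v l ≈ w l) → ∀ l → π v l ≈ π w l
  π-cong v≈w l = +-cong (v≈w l) (-‿cong (*-congʳ (c l) (dot-congˡ ν v≈w)))

  π-linComb : ∀ {k} (e : Fin k → ℤ) (Q : Mat k n) l → π (linComb e Q) l ≡ linComb e (λ i → π (Q i)) l
  π-linComb {ℕ.zero} e Q l = trans (cong (λ t → + 0 - t * c l) (sumℤ-0 {n})) (vanish (c l))
    where vanish : ∀ x → + 0 - + 0 * x ≡ + 0
          vanish = solve-∀
  π-linComb {ℕ.suc k} e Q l = begin
    π (linComb e Q) l
      ≡⟨ cong (λ t → linComb e Q l - t * c l) (dot-*+ (e zero) (Q zero) L ν) ⟩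
    (e zero * Q zero l + L l) - (e zero * dot (Q zero) ν + dot L ν) * c l
      ≡⟨ regroup (e zero) (Q zero l) (L l) (dot (Q zero) ν) (dot L ν) (c l) ⟩
    e zero * π (Q zero) l + π L l
      ≡⟨ cong (_+_ (e zero * π (Q zero) l)) (π-linComb (λ i → e (suc i)) (λ i → Q (suc i)) l) ⟩
    linComb e (λ i → π (Q i)) l
      ∎
    where
      open ≡-Reasoning
      L : RowVec n
      L = linComb (λ i → e (suc i)) (λ i → Q (suc i))
      regroup : ∀ a x y d₁ d₂ z → (a * x + y) - (a * d₁ + d₂) * z ≡ a * (x - d₁ * z) + (y - d₂ * z)
      regroup = solve-∀

  π-∈Span : ∀ {k} {Q : Mat k n} {v} → v ∈Span Q → π v ∈Span (λ i → π (Q i))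
  π-∈Span {Q = Q} (e , v≈eQ) = e , λ l → ≈-trans (π-cong v≈eQ l) (≈-reflexive (π-linComb e Q l))

  π-fix : ∀ v → dot v ν ≈ + 0 → ∀ l → π v l ≈ v l
  π-fix v v·ν≈0 l = ≈-trans (+-congˡ (v l) (-‿cong (*-congʳ (c l) v·ν≈0))) (≈-reflexive (vanish (v l) (c l)))
    where vanish : ∀ x y → x - + 0 * y ≡ x
          vanish = solve-∀

  π-kills : ∀ l → π c l ≈ + 0
  π-kills l = ≈-trans (+-congˡ (c l) (-‿cong (*-congʳ (c l) c·ν≈1))) (≈-reflexive (vanish (c l)))
    where vanish : ∀ x → x - + 1 * x ≡ + 0
          vanish = solve-∀

  π⁻¹-∈Span : ∀ {t} {Q : Mat t n} {v} → π v ∈Span Q → v ∈Span (c ∷ Q)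
  π⁻¹-∈Span {v = v} (e , πv≈eQ) =
    (dot v ν ∷ e) , λ l →
      ≈-trans (≈-reflexive (split (v l) (dot v ν * c l))) (+-congˡ (dot v ν * c l) (πv≈eQ l))
    where split : ∀ x y → x ≡ y + (x - y)
          split = solve-∀

module Reduction {p : ℕ} (p-prime : Prime p) (s n : ℕ) (s≥1 : s ≥ 1) where

  open Congruence (p ^ s)
  open Spans (p ^ s) n

  p∣pˢ : + p ∣ + (p ^ s)
  p∣pˢ = ∣ᵤ⇒∣ (p∣p^s s≥1)
    where p∣p^s : ∀ {s} → s ≥ 1 → p ℕ∣.∣ p ^ s
          p∣p^s {ℕ.suc s} _ = ℕ∣.m∣m*n (p ^ s)

  module Pivot (c ν : Fin n → ℤ) (c·ν≈1 : dot c ν ≈ + 1) where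

    open Projection (p ^ s) n c ν c·ν≈1

    -- If p divided every coefficient it would divide c, hence c ν ≈ 1, hence 1.
    unit-coefficient : ∀ {r} (w : Fin r → ℤ) (Q : Mat r n) → (∀ l → c l ≈ linComb w Q l) →
      ∃ λ j → ¬ (+ p ∣ w j)
    unit-coefficient {r} w Q c≈wQ = FinP.¬∀⟶∃¬ r (λ j → + p ∣ w j) (λ j → + p ∣? w j) p∤w
      where
        p∤w : ¬ (∀ j → + p ∣ w j)
        p∤w p∣w = ℕ.nonTrivial⇒≢1 {{prime⇒nonTrivial p-prime}} (ℕ∣.∣1⇒≡1 (∣⇒∣ᵤ p∣1))
          where
            p∣c : ∀ l → + p ∣ c l
            p∣c l = ∣-resp-≈ p∣pˢ (c≈wQ l) (sumℤ-∣ (λ i → ∣m⇒∣m*n (Q i l) (p∣w i)))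
            p∣1 : + p ∣ + 1
            p∣1 = ∣-resp-≈ p∣pˢ (≈-sym c·ν≈1) (sumℤ-∣ (λ l → ∣m⇒∣m*n (ν l) (p∣c l)))

    ∉Span-empty : (Q : Mat 0 n) → ¬ c ∈Span Q
    ∉Span-empty Q (w , c≈wQ) = FinP.¬Fin0 (proj₁ (unit-coefficient w Q c≈wQ))

    module _ {r} (Q : Mat (ℕ.suc r) n) (c∈Q : c ∈Span Q) where

      private
        w : Fin (ℕ.suc r) → ℤ
        w = proj₁ c∈Q
        pivot : Fin (ℕ.suc r)
        pivot = proj₁ (unit-coefficient w Q (proj₂ c∈Q))
        pivot-invertible : ∃ λ u → w pivot * u ≈ + 1
        pivot-invertible = invertible-mod-prime-power p-prime s (w pivot) (proj₂ (unit-coefficient w Q (proj₂ c∈Q)))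
        u : ℤ
        u = proj₁ pivot-invertible
        wu≈1 : w pivot * u ≈ + 1
        wu≈1 = proj₂ pivot-invertible

      reduced : Mat r n
      reduced i = π (Q (punchIn pivot i))

      private
        rest : RowVec n
        rest = linComb (λ i → w (punchIn pivot i)) reduced

        pivot-relation : ∀ l → w pivot * π (Q pivot) l + rest l ≈ + 0
        pivot-relation l = begin
          w pivot * π (Q pivot) l + rest l   ≡⟨ sumℤ-punchIn pivot (λ i → w i * π (Q i) l) ⟨
          linComb w (λ i → π (Q i)) l        ≡⟨ π-linComb w Q l ⟨
          π (linComb w Q) l                  ≈⟨ π-cong (proj₂ c∈Q) l ⟨
          π c l                              ≈⟨ π-kills l ⟩
          + 0                                ∎
          where open import Relation.Binary.Reasoning.Setoid ≈-setoid

        π-pivot∈reduced : π (Q pivot) ∈Span reduced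
        π-pivot∈reduced = (λ i → - u * w (punchIn pivot i)) , λ l → begin
          π (Q pivot) l                                          ≈⟨ unit-cancel l ⟩
          u * (w pivot * π (Q pivot) l + rest l) + - u * rest l  ≈⟨ +-cong (*-congˡ u (pivot-relation l)) ≈-refl ⟩
          u * + 0 + - u * rest l                                 ≡⟨ simplify u (rest l) ⟩
          - u * rest l                                           ≡⟨ linComb-* (- u) (λ i → w (punchIn pivot i)) reduced l ⟨
          linComb (λ i → - u * w (punchIn pivot i)) reduced l    ∎
          where
            open import Relation.Binary.Reasoning.Setoid ≈-setoid
            simplify : ∀ u b → u * + 0 + - u * b ≡ - u * b
            simplify = solve-∀
            expand : ∀ w u x b → u * (w * x + b) + - u * b ≡ (w * u) * x
            expand = solve-∀
            unit-cancel : ∀ l → π (Q pivot) l ≈ u * (w pivot * π (Q pivot) l + rest l) + - u * rest l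
            unit-cancel l =
              ≈-trans (≈-sym (≈-trans (*-congʳ (π (Q pivot) l) wu≈1) (≈-reflexive (ℤP.*-identityˡ _))))
                      (≈-reflexive (sym (expand (w pivot) u (π (Q pivot) l) (rest l))))

        πQ⊆reduced : (λ i → π (Q i)) ⊆Span reduced
        πQ⊆reduced = punchIn-elim pivot π-pivot∈reduced (⊆Span-refl reduced)

      π-∈Span-reduced : ∀ {v} → v ∈Span Q → π v ∈Span reduced
      π-∈Span-reduced v∈Q = ∈Span-⊆ πQ⊆reduced (π-∈Span {Q = Q} v∈Q)

      ⊆Span-∷ : ∀ {t} {P : Mat t n} → reduced ⊆Span P → Q ⊆Span (c ∷ P)
      ⊆Span-∷ reduced⊆P i = π⁻¹-∈Span (∈Span-⊆ reduced⊆P (π-∈Span-reduced (⊆Span-refl Q i)))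

  spanning-set-of-sum : ∀ k (α : Mat k n) (N : Mat n k) → (∀ i j → (α ⊗ N) i j ≈ δ i j) →
    ∀ {r₁ r₂} (Q₁ : Mat r₁ n) (Q₂ : Mat r₂ n) → α ⊆Span Q₁ → α ⊆Span Q₂ →
    Σ ℕ λ t → t ℕ.+ k ℕ.≤ r₁ ℕ.+ r₂ × Σ (Mat t n) λ Q → Q₁ ⊆Span Q × Q₂ ⊆Span Q
  spanning-set-of-sum ℕ.zero α N _ {r₁} {r₂} Q₁ Q₂ _ _ =
    r₁ ℕ.+ r₂ , ℕP.≤-reflexive (ℕP.+-identityʳ (r₁ ℕ.+ r₂)) , stack Q₁ Q₂ ,
    stack-⊆Spanˡ Q₁ Q₂ (⊆Span-refl (stack Q₁ Q₂)) , stack-⊆Spanʳ Q₁ Q₂ (⊆Span-refl (stack Q₁ Q₂))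
  spanning-set-of-sum (ℕ.suc k) α N α⊗N≈δ {ℕ.zero} Q₁ Q₂ α⊆Q₁ α⊆Q₂ =
    ⊥-elim (Pivot.∉Span-empty (α zero) (λ l → N l zero) (α⊗N≈δ zero zero) Q₁ (α⊆Q₁ zero))
  spanning-set-of-sum (ℕ.suc k) α N α⊗N≈δ {ℕ.suc _} {ℕ.zero} Q₁ Q₂ α⊆Q₁ α⊆Q₂ =
    ⊥-elim (Pivot.∉Span-empty (α zero) (λ l → N l zero) (α⊗N≈δ zero zero) Q₂ (α⊆Q₂ zero))
  spanning-set-of-sum (ℕ.suc k) α N α⊗N≈δ {ℕ.suc r₁} {ℕ.suc r₂} Q₁ Q₂ α⊆Q₁ α⊆Q₂ =
    let t , t+k≤r₁+r₂ , Q , Q₁'⊆Q , Q₂'⊆Q =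
          spanning-set-of-sum k (λ i → α (suc i)) (λ l j → N l (suc j)) (λ i j → α⊗N≈δ (suc i) (suc j))
            (reduced Q₁ (α⊆Q₁ zero)) (reduced Q₂ (α⊆Q₂ zero))
            (tail⊆reduced Q₁ α⊆Q₁) (tail⊆reduced Q₂ α⊆Q₂)
    in ℕ.suc t , suc-mono t+k≤r₁+r₂ , α zero ∷ Q ,
       ⊆Span-∷ Q₁ (α⊆Q₁ zero) Q₁'⊆Q , ⊆Span-∷ Q₂ (α⊆Q₂ zero) Q₂'⊆Q
    where
      ν : Fin n → ℤ
      ν l = N l zero
      open Projection (p ^ s) n (α zero) ν (α⊗N≈δ zero zero)
      open Pivot (α zero) ν (α⊗N≈δ zero zero)
      tail⊆reduced : ∀ {r} (Q : Mat (ℕ.suc r) n) (α⊆Q : α ⊆Span Q) →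
        (λ i → α (suc i)) ⊆Span reduced Q (α⊆Q zero)
      tail⊆reduced Q α⊆Q i =
        ∈Span-resp-≈ (λ l → ≈-sym (π-fix (α (suc i)) (α⊗N≈δ (suc i) zero) l))
                     (π-∈Span-reduced Q (α⊆Q zero) (α⊆Q (suc i)))
      suc-mono : ∀ {t k r₁ r₂} → t ℕ.+ k ℕ.≤ r₁ ℕ.+ r₂ → ℕ.suc t ℕ.+ ℕ.suc k ℕ.≤ ℕ.suc r₁ ℕ.+ ℕ.suc r₂
      suc-mono {t} {k} {r₁} {r₂} le =
        subst₂ ℕ._≤_ (sym (ℕP.+-suc (ℕ.suc t) k)) (sym (ℕP.+-suc (ℕ.suc r₁) r₂)) (ℕ.s≤s (ℕ.s≤s le))

unimodular⇒δ : ∀ q {k n} (α : Mat k n) → Unimodular q α →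
  Σ (Mat n k) λ N → ∀ i j → Congruence._≈_ q ((α ⊗ N) i j) (δ i j)
unimodular⇒δ q α (N , α⊗N≡id) =
  N , λ i j → ≈-trans (≡[]⇒≈ {y = idMat i j} (α⊗N≡id i j)) (≈-reflexive (idMat≡δ i j))
  where open Congruence q

innerRank-triangle : ∀ {p} → Prime p → ∀ s {n} → s ≥ 1 →
  ∀ {kA kB kC} (A : Mat kA n) (B : Mat kB n) (C : Mat kC n) {dC rAB rAC rCB} →
  IsDim (p ^ s) (RowSpan (p ^ s) C) dC →
  IsInnerRank (p ^ s) (stack A B) rAB → IsInnerRank (p ^ s) (stack A C) rAC → IsInnerRank (p ^ s) (stack C B) rCB →
  rAB ℕ.+ dC ℕ.≤ rAC ℕ.+ rCB
innerRank-triangle {p} p-prime s {n} s≥1 A B C {dC}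
  ((α , α∈C , α-unimodular) , _) ρAB ((F₁ , G₁ , F₁G₁≡AC) , _) ((F₂ , G₂ , F₂G₂≡CB) , _) =
  let N , α⊗N≈δ = unimodular⇒δ (p ^ s) α α-unimodular
      t , t+dC≤ , Q , G₁⊆Q , G₂⊆Q = spanning-set-of-sum dC α N α⊗N≈δ G₁ G₂
        (⊆Span-trans α⊆C (stack-⊆Spanʳ A C AC⊆G₁)) (⊆Span-trans α⊆C (stack-⊆Spanˡ C B CB⊆G₂))
      AB⊆Q : stack A B ⊆Span Q
      AB⊆Q = stack-⊆Span (⊆Span-trans (stack-⊆Spanˡ A C AC⊆G₁) G₁⊆Q)
                         (⊆Span-trans (stack-⊆Spanʳ C B CB⊆G₂) G₂⊆Q)
  in ℕP.≤-trans (ℕP.+-monoˡ-≤ dC (innerRank≤ ρAB AB⊆Q)) t+dC≤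
  where
    open Spans (p ^ s) n
    open Reduction p-prime s n s≥1
    α⊆C : α ⊆Span C
    α⊆C i = rowSpan⇒∈Span (α∈C i)
    AC⊆G₁ : stack A C ⊆Span G₁
    AC⊆G₁ = factorisation⇒⊆Span F₁ G₁ F₁G₁≡AC
    CB⊆G₂ : stack C B ⊆Span G₂
    CB⊆G₂ = factorisation⇒⊆Span F₂ G₂ F₂G₂≡CB

IsDim-unique : ∀ q {n} {V : Submodule n} {d d'} → IsDim q V d → IsDim q V d' → d ≡ d'
IsDim-unique q ((α , α∈V , α-unimodular) , maximal) ((β , β∈V , β-unimodular) , maximal') =
  ℕP.≤-antisym (maximal' _ α α∈V α-unimodular) (maximal _ β β∈V β-unimodular)

IsAd⇒innerRank : ∀ q {k l n} {X : Mat k n} {Y : Mat l n} {dX dY a} →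
  IsDim q (RowSpan q X) dX → IsDim q (RowSpan q Y) dY → IsAd q X Y a →
  ∃ λ r → IsInnerRank q (stack X Y) r × a ≡ adVal r dX dY
IsAd⇒innerRank q {X = X} {Y} DX DY (r , _ , _ , ρ , DX' , DY' , refl)
  rewrite IsDim-unique q {V = RowSpan q X} DX' DX | IsDim-unique q {V = RowSpan q Y} DY' DY = r , ρ , refl

⊔+⊓≡+ : ∀ m n → (m ℕ.⊔ n) ℕ.+ (m ⊓ n) ≡ m ℕ.+ n
⊔+⊓≡+ m n with ℕP.≤-total m n
... | inj₁ m≤n rewrite ℕP.m≤n⇒m⊔n≡n m≤n | ℕP.m≤n⇒m⊓n≡m m≤n = ℕP.+-comm n m
... | inj₂ n≤m rewrite ℕP.m≥n⇒m⊔n≡m n≤m | ℕP.m≥n⇒m⊓n≡n n≤m = refl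

pos-sub-mono : ∀ a b c d → a ℕ.+ d ℕ.≤ b ℕ.+ c → + a - + c ≤ + b - + d
pos-sub-mono a b c d a+d≤b+c =
  subst₂ _≤_ (cancel a d c) (cancel′ b c d) (ℤP.+-monoˡ-≤ (- (+ c + + d)) (+≤+ a+d≤b+c))
  where
    cancel : ∀ x y z → + (x ℕ.+ y) + - (+ z + + y) ≡ + x - + z
    cancel x y z = trans (cong (_+ - (+ z + + y)) (ℤP.pos-+ x y)) (ring (+ x) (+ y) (+ z))
      where ring : ∀ x y z → (x + y) + - (z + y) ≡ x - z
            ring = solve-∀
    cancel′ : ∀ x y z → + (x ℕ.+ y) + - (+ y + + z) ≡ + x - + z
    cancel′ x y z = trans (cong (_+ - (+ y + + z)) (ℤP.pos-+ x y)) (ring (+ x) (+ y) (+ z))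
      where ring : ∀ x y z → (x + y) + - (y + z) ≡ x - z
            ring = solve-∀

ad-triangle : ∀ {rAB rAC rCB} dA dB → rAB ℕ.+ dA ⊓ dB ℕ.≤ rAC ℕ.+ rCB →
  adVal rAB dA dB ≤ adVal rAC dA (dA ⊓ dB) + adVal rCB (dA ⊓ dB) dB
ad-triangle {rAB} {rAC} {rCB} dA dB rAB+m≤
  rewrite ℕP.m≥n⇒m⊔n≡m (ℕP.m⊓n≤m dA dB) | ℕP.m≤n⇒m⊔n≡n (ℕP.m⊓n≤n dA dB) =
  subst (_ ≤_) (split rAC rCB dA dB) (pos-sub-mono rAB (rAC ℕ.+ rCB) (dA ℕ.⊔ dB) (dA ℕ.+ dB) shifted)
  where
    shifted : rAB ℕ.+ (dA ℕ.+ dB) ℕ.≤ rAC ℕ.+ rCB ℕ.+ (dA ℕ.⊔ dB)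
    shifted = begin
      rAB ℕ.+ (dA ℕ.+ dB)                      ≡⟨ cong (rAB ℕ.+_) (⊔+⊓≡+ dA dB) ⟨
      rAB ℕ.+ ((dA ℕ.⊔ dB) ℕ.+ dA ⊓ dB)        ≡⟨ ℕP.+-comm rAB _ ⟩
      (dA ℕ.⊔ dB) ℕ.+ dA ⊓ dB ℕ.+ rAB          ≡⟨ ℕP.+-assoc (dA ℕ.⊔ dB) (dA ⊓ dB) rAB ⟩
      (dA ℕ.⊔ dB) ℕ.+ (dA ⊓ dB ℕ.+ rAB)        ≡⟨ cong ((dA ℕ.⊔ dB) ℕ.+_) (ℕP.+-comm (dA ⊓ dB) rAB) ⟩
      (dA ℕ.⊔ dB) ℕ.+ (rAB ℕ.+ dA ⊓ dB)        ≤⟨ ℕP.+-monoʳ-≤ (dA ℕ.⊔ dB) rAB+m≤ ⟩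
      (dA ℕ.⊔ dB) ℕ.+ (rAC ℕ.+ rCB)            ≡⟨ ℕP.+-comm (dA ℕ.⊔ dB) (rAC ℕ.+ rCB) ⟩
      rAC ℕ.+ rCB ℕ.+ (dA ℕ.⊔ dB)              ∎
      where open ℕP.≤-Reasoning
    split : ∀ a b c d → + (a ℕ.+ b) - + (c ℕ.+ d) ≡ (+ a - + c) + (+ b - + d)
    split a b c d = trans (cong₂ (λ x y → x - y) (ℤP.pos-+ a b) (ℤP.pos-+ c d)) (ring (+ a) (+ b) (+ c) (+ d))
      where ring : ∀ a b c d → (a + b) - (c + d) ≡ (a - c) + (b - d)
            ring = solve-∀

theorem3p8 : ∀ (p s n : ℕ) → Prime p → s ≥ 1 →
    ∀ {kA kB kC} (A : Mat kA n) (B : Mat kB n) (C : Mat kC n) →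
    IsSubspaceRep (p ^ s) A → IsSubspaceRep (p ^ s) B → IsSubspaceRep (p ^ s) C →
    ∀ (dA dB dC : ℕ) →
    IsDim (p ^ s) (RowSpan (p ^ s) A) dA →
    IsDim (p ^ s) (RowSpan (p ^ s) B) dB →
    IsDim (p ^ s) (RowSpan (p ^ s) C) dC →
    dC ≡ dA ⊓ dB →
    ∀ (x y z : ℤ) → IsAd (p ^ s) A B x → IsAd (p ^ s) A C y → IsAd (p ^ s) C B z →
    x ≤ y + z
theorem3p8 p s n p-prime s≥1 A B C _ _ _ dA dB dC DA DB DC refl x y z adAB adAC adCB
  with IsAd⇒innerRank (p ^ s) DA DB adAB | IsAd⇒innerRank (p ^ s) DA DC adAC | IsAd⇒innerRank (p ^ s) DC DB adCB
... | rAB , ρAB , refl | rAC , ρAC , refl | rCB , ρCB , refl =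
  ad-triangle dA dB (innerRank-triangle p-prime s s≥1 A B C DC ρAB ρAC ρCB)
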